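{- Consider a family $\mathcal F$ of pairs $(G,r)$, where each $G$ is a finite, undirected, connected, unweighted graph without loops or multi-edges and $r\in V(G)$. For $(G,r)\in\mathcal F$, let $C_1,\dots,C_l$ be the connected components of the graph obtained from $G$ by deleting $r$, and for $i\in\{1,\dots,l\}$ let $V_i=\sum_{j\ne i}|V(C_j)|$. Suppose $V_i=\Theta(|V(G)|)$ for all $i$ uniformly over the family, i.e. there is a constant $c>0$ such that $V_i\ge c\,|V(G)|$ for every $(G,r)\in\mathcal F$ and every $i\in\{1,\dots,l\}$. Then $\mu(r)$ is a constant, i.e. there is a constant $C$ (independent of the member of the family) such that for every $(G,r)\in\mathcal F$ and every $v\in V(G)$, $\delta_{v\bullet}(r)\le C\cdot \overline{\delta(r)}$, where $\overline{\delta(r)}=\frac{1}{|V(G)|}\sum_{w\in V(G)}\delta_{w\bullet}(r)$.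
   Context: For $s,t\in V(G)$, $\sigma_{st}$ is the number of shortest paths between $s$ and $t$ and $\sigma_{st}(v)$ is the number of those passing through $v$ as an interior vertex. The dependency score of $s$ on $v$ is $\delta_{s\bullet}(v)=\sum_{t\in V(G)\setminus\{v,s\}}\sigma_{st}(v)/\sigma_{st}$ (with $\delta_{v\bullet}(v)=0$). The quantity $\mu(r)$ is a value such that $\delta_{v\bullet}(r)\le\mu(r)\,\overline{\delta(r)}$ for all $v\in V(G)$. -}

module Defs where

open import Data.Bool using (Bool; true; false; if_then_else_; _∧_; _∨_; not)
open import Data.Nat using (ℕ; zero; suc; _∸_)
open import Data.Fin using (Fin)
open import Data.Fin.Properties using (_≟_)
open import Data.List using (List; []; _∷_; [_]; map; concatMap; filterᵇ; length; foldr; allFin; upTo)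
open import Data.Bool.ListAction using (any)
open import Data.Integer using (+_)
open import Data.Rational using (ℚ; 0ℚ; _+_; _*_; _/_)
open import Relation.Nullary.Decidable using (⌊_⌋)
open import Relation.Binary.PropositionalEquality using (_≡_)
open import Data.Product using (∃-syntax)

-- A finite simple undirected graph on the vertex set Fin n:
-- Boolean adjacency (so no multi-edges), symmetric, irreflexive (no loops).
record Graph (n : ℕ) : Set where
  field
    adj    : Fin n → Fin n → Bool
    adj-sym : ∀ u v → adj u v ≡ adj v u
    adj-irrefl : ∀ u → adj u u ≡ false
open Graph public

module _ {n : ℕ} where

  eqᵇ : Fin n → Fin n → Bool
  eqᵇ u v = ⌊ u ≟ v ⌋

  seqs : ℕ → List (List (Fin n))
  seqs zero = [ [] ]
  seqs (suc k) = concatMap (λ v → map (v ∷_) (seqs k)) (allFin n)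

  isWalkᵇ : Graph n → List (Fin n) → Bool
  isWalkᵇ G [] = true
  isWalkᵇ G (x ∷ []) = true
  isWalkᵇ G (x ∷ y ∷ ys) = adj G x y ∧ isWalkᵇ G (y ∷ ys)

  headIsᵇ : Fin n → List (Fin n) → Bool
  headIsᵇ s [] = false
  headIsᵇ s (x ∷ _) = eqᵇ x s

  lastIsᵇ : Fin n → List (Fin n) → Bool
  lastIsᵇ t [] = false
  lastIsᵇ t (x ∷ []) = eqᵇ x t
  lastIsᵇ t (x ∷ y ∷ ys) = lastIsᵇ t (y ∷ ys)

  -- all walks from s to t with exactly k edges (as vertex lists of length k+1)
  walks : Graph n → Fin n → Fin n → ℕ → List (List (Fin n))
  walks G s t k = filterᵇ (λ p → headIsᵇ s p ∧ lastIsᵇ t p ∧ isWalkᵇ G p) (seqs (suc k))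

  nonEmptyᵇ : {A : Set} → List A → Bool
  nonEmptyᵇ [] = false
  nonEmptyᵇ (_ ∷ _) = true

  Connected : Graph n → Set
  Connected G = ∀ s t → ∃[ k ] (nonEmptyᵇ (walks G s t k) ≡ true)

  searchDist : Graph n → Fin n → Fin n → ℕ → ℕ → ℕ
  searchDist G s t i zero = i
  searchDist G s t i (suc fuel) =
    if nonEmptyᵇ (walks G s t i) then i else searchDist G s t (suc i) fuel

  -- distance d(s,t) (in a connected graph on n vertices, d(s,t) ≤ n - 1)
  dist : Graph n → Fin n → Fin n → ℕ
  dist G s t = searchDist G s t 0 n

  -- shortest s-t paths: the walks of minimal length d(s,t) (these are paths)
  shortestPaths : Graph n → Fin n → Fin n → List (List (Fin n))
  shortestPaths G s t = walks G s t (dist G s t)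

  dropLast : List (Fin n) → List (Fin n)
  dropLast [] = []
  dropLast (x ∷ []) = []
  dropLast (x ∷ y ∷ ys) = x ∷ dropLast (y ∷ ys)

  interior : List (Fin n) → List (Fin n)
  interior [] = []
  interior (x ∷ xs) = dropLast xs

  σ : Graph n → Fin n → Fin n → ℕ
  σ G s t = length (shortestPaths G s t)

  σ-via : Graph n → Fin n → Fin n → Fin n → ℕ
  σ-via G s t v = length (filterᵇ (λ p → any (eqᵇ v) (interior p)) (shortestPaths G s t))

  -- a / b as a rational (b = 0 gives 0; never used since σ_st ≥ 1 in connected graphs)
  ratio : ℕ → ℕ → ℚ
  ratio a zero = 0ℚ
  ratio a (suc b) = (+ a) / suc b

  sumℚ : List ℚ → ℚ
  sumℚ = foldr _+_ 0ℚ

  -- dependency score δ_{s•}(v) = Σ_{t ∉ {v,s}} σ_st(v)/σ_st, with δ_{v•}(v) = 0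
  δ : Graph n → Fin n → Fin n → ℚ
  δ G s v = if eqᵇ s v then 0ℚ else
    sumℚ (map (λ t → ratio (σ-via G s t v) (σ G s t))
              (filterᵇ (λ t → not (eqᵇ t v ∨ eqᵇ t s)) (allFin n)))

  δ-avg : Graph n → Fin n → ℚ
  δ-avg G v = sumℚ (map (λ w → δ G w v) (allFin n)) * ratio 1 n

  -- u reaches w in G − r (walk avoiding r; walks of length < n suffice)
  reachAvoidᵇ : Graph n → Fin n → Fin n → Fin n → Bool
  reachAvoidᵇ G r u w =
    any (λ k → nonEmptyᵇ (filterᵇ (λ p → not (any (eqᵇ r) p)) (walks G u w k))) (upTo n)

  compSize : Graph n → Fin n → Fin n → ℕ
  compSize G r u = length (filterᵇ (λ w → reachAvoidᵇ G r u w) (allFin n))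

  -- V_i = Σ_{j≠i} |V(C_j)| = (|V(G)| − 1) − |V(C_i)| for the component C_i containing u
  otherCompsSize : Graph n → Fin n → Fin n → ℕ
  otherCompsSize G r u = (n ∸ 1) ∸ compSize G r u

module Submission where

-- If every component C_i of G − r misses a linear number V_i ≥ c·|V(G)| of
-- the other vertices, then μ(r) ≤ 1/c.  Write |V(G)| = m + 1.
--
-- Each term σ_st(r)/σ_st of δ_{v•}(r) lies in [0,1] and
--    t = r is never summed over, so δ_{v•}(r) ≤ m for every v.
--  * Lower bound.  For w ≠ r and any t ≠ r outside the component of w in
--    G − r, every shortest w–t path meets r, necessarily as an interior
--    vertex, so σ_wt(r)/σ_wt = 1.  There are at least V_i ≥ c(m + 1) such t,
--    hence δ_{w•}(r) ≥ c(m + 1), and summing over the m vertices w ≠ r gives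
--    the average bound c·m ≤ \overline{δ(r)}.
--  * Hence δ_{v•}(r) ≤ m ≤ (1/c)·\overline{δ(r)}.

open import Defs
open import Data.Bool using (Bool; true; false; T; not; _∧_; _∨_)
open import Data.Bool.ListAction using (any)
open import Data.Bool.Properties using (T-∧)
open import Data.Empty using (⊥-elim)
open import Data.Fin using (Fin; zero; suc)
open import Data.Fin.Properties using (_≟_; injective⇒≤)
open import Data.Integer using (+_)
import Data.Integer as ℤ
import Data.Integer.Properties as ℤₚ
open import Data.List using (List; []; _∷_; length; map; filterᵇ; allFin; tabulate)
open import Data.List.Membership.Propositional using (_∈_; _∉_; lose)
open import Data.List.Membership.Propositional.Properties
  using (∈-map⁺; ∈-map⁻; ∈-concat⁺′; ∈-concat⁻′; ∈-allFin; ∈-upTo⁺; ∈-filter⁺; ∈-filter⁻)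
open import Data.List.Properties
  using (length-tabulate; map-tabulate; length-filter; filter-accept; filter-all; filter-none; filter-notAll)
import Data.List.Relation.Unary.All as All
open import Data.List.Relation.Unary.Any using (here; there)
import Data.List.Relation.Unary.Any as Any
open import Data.List.Relation.Unary.Any.Properties using (any⁺; any⁻)
open import Data.Nat using (ℕ; zero; suc; z≤n; s≤s)
import Data.Nat as ℕ
import Data.Nat.Properties as ℕₚ
open import Data.Product using (Σ; ∃-syntax; _×_; _,_; proj₁; proj₂)
open import Data.Rational
  using (ℚ; 0ℚ; 1ℚ; _+_; _*_; _/_; _≤_; _<_; 1/_; toℚᵘ; NonZero; NonNegative; positive; nonNegative)
open import Data.Rational.Properties
  using ( ≤-refl; ≤-reflexive; ≤-trans; module ≤-Reasoning; +-mono-≤; +-monoˡ-≤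
        ; +-identityˡ; *-identityˡ; *-identityʳ; *-zeroˡ; *-assoc; *-comm; *-distribʳ-+
        ; *-inverseˡ; *-monoˡ-≤-nonNeg; *-monoʳ-≤-nonNeg
        ; toℚᵘ-fromℚᵘ; toℚᵘ-injective; toℚᵘ-cancel-≤; toℚᵘ-homo-+; toℚᵘ-homo-*
        ; nonNegative⁻¹; normalize-nonNeg; pos⇒nonZero; pos⇒nonNeg; 1/pos⇒pos )
open import Data.Rational.Unnormalised using (mkℚᵘ; *≡*; *≤*)
import Data.Rational.Unnormalised as ℚᵘ
import Data.Rational.Unnormalised.Properties as ℚᵘₚ
open import Data.Sum using (inj₁; inj₂)
open import Data.Unit using (⊤; tt)
open import Function using (_∘_; Equivalence)
open import Relation.Nullary using (¬_; yes; no)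
open import Relation.Nullary.Decidable using (T?; toWitness; fromWitness)
open import Relation.Binary.PropositionalEquality

∧-intro : ∀ {a b} → T a → T b → T (a ∧ b)
∧-intro ta tb = Equivalence.from T-∧ (ta , tb)

∧-elim : ∀ {a b} → T (a ∧ b) → T a × T b
∧-elim = Equivalence.to T-∧

not-intro : ∀ {b} → ¬ T b → T (not b)
not-intro {false} _  = tt
not-intro {true}  ¬b = ¬b tt

not-elim : ∀ {b} → T (not b) → ¬ T b
not-elim {false} _ ()

nor-intro : ∀ {a b} → ¬ T a → ¬ T b → T (not (a ∨ b))
nor-intro {true}  ¬a _  = ¬a tt
nor-intro {false} _  ¬b = not-intro ¬b

nor-elim : ∀ {a b} → T (not (a ∨ b)) → ¬ T a × ¬ T b
nor-elim {false} {false} _ = (λ ()) , (λ ())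

eqᵇ-suc : ∀ {n} (a b : Fin n) → eqᵇ (suc a) (suc b) ≡ eqᵇ a b
eqᵇ-suc a b with a ≟ b
... | yes _ = refl
... | no  _ = refl

ι : ℕ → ℚ
ι m = (+ m) / 1

toℚᵘ-/ : ∀ a b → toℚᵘ ((+ a) / suc b) ℚᵘ.≃ mkℚᵘ (+ a) b
toℚᵘ-/ a b = toℚᵘ-fromℚᵘ (mkℚᵘ (+ a) b)

ι-suc : ∀ m → ι (suc m) ≡ 1ℚ + ι m
ι-suc m = toℚᵘ-injective (begin-equality
  toℚᵘ (ι (suc m))           ≃⟨ toℚᵘ-/ (suc m) 0 ⟩
  mkℚᵘ (+ suc m) 0           ≃⟨ *≡* (cong (ℤ._* + 1) (sym (cong₂ ℤ._+_ (ℤₚ.*-identityʳ (+ 1)) (ℤₚ.*-identityʳ (+ m))))) ⟩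
  ℚᵘ.1ℚᵘ ℚᵘ.+ mkℚᵘ (+ m) 0    ≃⟨ ℚᵘₚ.+-congʳ ℚᵘ.1ℚᵘ (ℚᵘₚ.≃-sym (toℚᵘ-/ m 0)) ⟩
  toℚᵘ 1ℚ ℚᵘ.+ toℚᵘ (ι m)    ≃⟨ ℚᵘₚ.≃-sym (toℚᵘ-homo-+ 1ℚ (ι m)) ⟩
  toℚᵘ (1ℚ + ι m)            ∎)
  where open ℚᵘₚ.≤-Reasoning

ι-mono : ∀ {m k} → m ℕ.≤ k → ι m ≤ ι k
ι-mono {m} {k} m≤k = toℚᵘ-cancel-≤ (begin
  toℚᵘ (ι m)     ≃⟨ toℚᵘ-/ m 0 ⟩
  mkℚᵘ (+ m) 0   ≤⟨ *≤* (ℤₚ.*-monoʳ-≤-nonNeg (+ 1) (ℤ.+≤+ m≤k)) ⟩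
  mkℚᵘ (+ k) 0   ≃⟨ ℚᵘₚ.≃-sym (toℚᵘ-/ k 0) ⟩
  toℚᵘ (ι k)     ∎)
  where open ℚᵘₚ.≤-Reasoning

module _ {n : ℕ} where

  ratio-nonneg : ∀ a b → 0ℚ ≤ ratio {n} a b
  ratio-nonneg a zero    = ≤-refl
  ratio-nonneg a (suc b) = nonNegative⁻¹ ((+ a) / suc b) {{normalize-nonNeg a (suc b)}}

  ratio-≤-1 : ∀ {a b} → a ℕ.≤ b → ratio {n} a b ≤ 1ℚ
  ratio-≤-1 {a} {zero}  _   = nonNegative⁻¹ 1ℚ
  ratio-≤-1 {a} {suc b} a≤b = toℚᵘ-cancel-≤ (begin
    toℚᵘ ((+ a) / suc b)   ≃⟨ toℚᵘ-/ a b ⟩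
    mkℚᵘ (+ a) b           ≤⟨ *≤* (subst₂ ℤ._≤_ (sym (ℤₚ.*-identityʳ (+ a))) (sym (ℤₚ.*-identityˡ (+ suc b))) (ℤ.+≤+ a≤b)) ⟩
    ℚᵘ.1ℚᵘ                 ∎)
    where open ℚᵘₚ.≤-Reasoning

  ratio-self : ∀ {a b} → a ≡ b → 1 ℕ.≤ b → ratio {n} a b ≡ 1ℚ
  ratio-self {b = suc b} refl _ = toℚᵘ-injective (ℚᵘₚ.≃-trans (toℚᵘ-/ (suc b) b)
    (*≡* (trans (ℤₚ.*-identityʳ (+ suc b)) (sym (ℤₚ.*-identityˡ (+ suc b))))))

  ι-*-ratio : ∀ m → ι (suc m) * ratio {n} 1 (suc m) ≡ 1ℚ
  ι-*-ratio m = toℚᵘ-injective (begin-equality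
    toℚᵘ (ι (suc m) * ((+ 1) / suc m))             ≃⟨ toℚᵘ-homo-* (ι (suc m)) ((+ 1) / suc m) ⟩
    toℚᵘ (ι (suc m)) ℚᵘ.* toℚᵘ ((+ 1) / suc m)    ≃⟨ ℚᵘₚ.*-cong (toℚᵘ-/ (suc m) 0) (toℚᵘ-/ 1 m) ⟩
    mkℚᵘ (+ suc m) 0 ℚᵘ.* mkℚᵘ (+ 1) m            ≃⟨ *≡* (trans (ℤₚ.*-identityʳ _) (trans (ℤₚ.*-identityʳ (+ suc m))
                                                        (sym (trans (ℤₚ.*-identityˡ _) (cong (λ x → + suc x) (ℕₚ.+-identityʳ m)))))) ⟩
    ℚᵘ.1ℚᵘ                                          ∎)
    where open ℚᵘₚ.≤-Reasoning

count : ∀ {A : Set} → (A → Bool) → List A → ℕ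
count P xs = length (filterᵇ P xs)

module _ {A : Set} where

  count-complement : ∀ (P : A → Bool) xs → count P xs ℕ.+ count (not ∘ P) xs ≡ length xs
  count-complement P []       = refl
  count-complement P (x ∷ xs) with P x
  ... | true  = cong suc (count-complement P xs)
  ... | false = trans (ℕₚ.+-suc _ _) (cong suc (count-complement P xs))

  count-cover : ∀ (P Q : A → Bool) xs →
                length xs ℕ.≤ count P xs ℕ.+ (count Q xs ℕ.+ count (λ x → not (P x ∨ Q x)) xs)
  count-cover P Q []       = z≤n
  count-cover P Q (x ∷ xs) with P x | Q x | count-cover P Q xs
  ... | true  | true  | ih = s≤s (ℕₚ.≤-trans ih (ℕₚ.+-monoʳ-≤ (count P xs) (ℕₚ.n≤1+n _)))
  ... | true  | false | ih = s≤s ih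
  ... | false | true  | ih = ℕₚ.≤-trans (s≤s ih) (ℕₚ.≤-reflexive (sym (ℕₚ.+-suc (count P xs) _)))
  ... | false | false | ih = ℕₚ.≤-trans (s≤s ih) (ℕₚ.≤-reflexive (sym (trans
        (cong (count P xs ℕ.+_) (ℕₚ.+-suc (count Q xs) _)) (ℕₚ.+-suc (count P xs) _))))

  count-map : ∀ {B : Set} (P : B → Bool) (g : A → B) xs → count P (map g xs) ≡ count (P ∘ g) xs
  count-map P g []       = refl
  count-map P g (x ∷ xs) with P (g x)
  ... | true  = cong suc (count-map P g xs)
  ... | false = count-map P g xs

  count-cong : ∀ {P Q : A → Bool} xs → (∀ x → P x ≡ Q x) → count P xs ≡ count Q xs
  count-cong []       P≗Q = refl
  count-cong {P} {Q} (x ∷ xs) P≗Q with P x | Q x | P≗Q x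
  ... | true  | true  | refl = cong suc (count-cong xs P≗Q)
  ... | false | false | refl = count-cong xs P≗Q

-- allFin (suc n) is zero followed by the successors of allFin n.
count-allFin-suc : ∀ {n} (P : Fin (suc n) → Bool) → count P (tabulate suc) ≡ count (P ∘ suc) (allFin n)
count-allFin-suc {n} P = trans (cong (count P) (sym (map-tabulate (λ i → i) suc))) (count-map P suc (allFin n))

count-eq : ∀ {n} (r : Fin n) → count (λ t → eqᵇ t r) (allFin n) ≡ 1
count-eq {suc n} zero    = cong suc (trans (count-allFin-suc {n} (λ t → eqᵇ t zero))
  (cong length (filter-none (T? ∘ (λ t → eqᵇ (suc t) (zero {n}))) (All.universal (λ _ ()) (allFin n)))))
count-eq {suc n} (suc r) = trans (count-allFin-suc {n} (λ t → eqᵇ t (suc r)))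
  (trans (count-cong (allFin n) (λ t → eqᵇ-suc t r)) (count-eq r))

count-≢ : ∀ {m} (r : Fin (suc m)) → count (λ t → not (eqᵇ t r)) (allFin (suc m)) ≡ m
count-≢ {m} r = ℕₚ.suc-injective (begin
  suc (count (λ t → not (eqᵇ t r)) (allFin (suc m)))
    ≡⟨ cong (ℕ._+ count (λ t → not (eqᵇ t r)) (allFin (suc m))) (sym (count-eq r)) ⟩
  count (λ t → eqᵇ t r) (allFin (suc m)) ℕ.+ count (λ t → not (eqᵇ t r)) (allFin (suc m))
    ≡⟨ count-complement (λ t → eqᵇ t r) (allFin (suc m)) ⟩
  length (allFin (suc m))
    ≡⟨ length-tabulate (λ i → i) ⟩
  suc m ∎)
  where open ≡-Reasoning

module _ {n : ℕ} {A : Set} where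

  sum-nonneg : ∀ (f : A → ℚ) xs → (∀ x → 0ℚ ≤ f x) → 0ℚ ≤ sumℚ {n} (map f xs)
  sum-nonneg f []       f≥0 = ≤-refl
  sum-nonneg f (x ∷ xs) f≥0 = +-mono-≤ (f≥0 x) (sum-nonneg f xs f≥0)

  sum-≤-length : ∀ (f : A → ℚ) xs → (∀ x → f x ≤ 1ℚ) → sumℚ {n} (map f xs) ≤ ι (length xs)
  sum-≤-length f []       f≤1 = ≤-refl
  sum-≤-length f (x ∷ xs) f≤1 =
    ≤-trans (+-mono-≤ (f≤1 x) (sum-≤-length f xs f≤1)) (≤-reflexive (sym (ι-suc (length xs))))

  sum-filter-cons : ∀ (P : A → Bool) (f : A → ℚ) x xs → 0ℚ ≤ f x →
                    sumℚ {n} (map f (filterᵇ P xs)) ≤ sumℚ {n} (map f (filterᵇ P (x ∷ xs)))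
  sum-filter-cons P f x xs fx≥0 with P x
  ... | true  = ≤-trans (≤-reflexive (sym (+-identityˡ _))) (+-monoˡ-≤ _ fx≥0)
  ... | false = ≤-refl

  sum-filter-≥ : ∀ (P Q : A → Bool) (f : A → ℚ) (a : ℚ) xs → (∀ x → 0ℚ ≤ f x) →
                 (∀ x → T (Q x) → T (P x) × a ≤ f x) →
                 ι (count Q xs) * a ≤ sumℚ {n} (map f (filterᵇ P xs))
  sum-filter-≥ P Q f a []       f≥0 Q⇒ = ≤-reflexive (*-zeroˡ a)
  sum-filter-≥ P Q f a (x ∷ xs) f≥0 Q⇒ with Q x in Qx
  ... | false = ≤-trans (sum-filter-≥ P Q f a xs f≥0 Q⇒) (sum-filter-cons P f x xs (f≥0 x))
  ... | true with Px , a≤fx ← Q⇒ x (subst T (sym Qx) tt) = begin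
    ι (suc (count Q xs)) * a                  ≡⟨ cong (_* a) (ι-suc (count Q xs)) ⟩
    (1ℚ + ι (count Q xs)) * a                 ≡⟨ *-distribʳ-+ a 1ℚ (ι (count Q xs)) ⟩
    1ℚ * a + ι (count Q xs) * a               ≡⟨ cong (_+ ι (count Q xs) * a) (*-identityˡ a) ⟩
    a + ι (count Q xs) * a                    ≤⟨ +-mono-≤ a≤fx (sum-filter-≥ P Q f a xs f≥0 Q⇒) ⟩
    f x + sumℚ {n} (map f (filterᵇ P xs))     ≡⟨ cong (sumℚ {n} ∘ map f) (sym (filter-accept (T? ∘ P) Px)) ⟩
    sumℚ {n} (map f (filterᵇ P (x ∷ xs)))     ∎
    where open ≤-Reasoning

module _ {n : ℕ} where

  ∈⇒any : ∀ {r : Fin n} {xs} → r ∈ xs → T (any (eqᵇ r) xs)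
  ∈⇒any {r} r∈xs = any⁺ (eqᵇ r) (Any.map fromWitness r∈xs)

  any⇒∈ : ∀ {r : Fin n} xs → T (any (eqᵇ r) xs) → r ∈ xs
  any⇒∈ {r} xs h = Any.map toWitness (any⁻ (eqᵇ r) xs h)

  nonEmpty-intro : ∀ {A : Set} {x : A} {xs} → x ∈ xs → T (nonEmptyᵇ {n} xs)
  nonEmpty-intro (here _)  = tt
  nonEmpty-intro (there _) = tt

  ∈⇒length : ∀ {A : Set} {x : A} {xs} → x ∈ xs → 1 ℕ.≤ length xs
  ∈⇒length (here _)  = s≤s z≤n
  ∈⇒length (there _) = s≤s z≤n

  seqs-length : ∀ k {p} → p ∈ seqs {n} k → length p ≡ k
  seqs-length zero (here refl) = refl
  seqs-length (suc k) p∈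
    with _ , p∈vs , vs∈ ← ∈-concat⁻′ (map (λ v → map (v ∷_) (seqs k)) (allFin n)) p∈
    with v , _ , refl ← ∈-map⁻ (λ v → map (v ∷_) (seqs k)) vs∈
    with q , q∈ , refl ← ∈-map⁻ (v ∷_) p∈vs = cong suc (seqs-length k q∈)

  seqs-complete : ∀ (p : List (Fin n)) → p ∈ seqs (length p)
  seqs-complete []      = here refl
  seqs-complete (v ∷ q) = ∈-concat⁺′ (∈-map⁺ (v ∷_) (seqs-complete q))
                                     (∈-map⁺ (λ v → map (v ∷_) (seqs (length q))) (∈-allFin v))

module _ {n : ℕ} (G : Graph n) where

  open import Data.List.Membership.DecPropositional (_≟_ {n}) using (_∈?_)

  data Walk : Fin n → Fin n → ℕ → Set where
    stop : ∀ s → Walk s s 0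
    step : ∀ {s u t k} → T (adj G s u) → Walk u t k → Walk s t (suc k)

  vertices : ∀ {s t k} → Walk s t k → List (Fin n)
  vertices (stop s)       = s ∷ []
  vertices (step {s} _ w) = s ∷ vertices w

  vertices-length : ∀ {s t k} (w : Walk s t k) → length (vertices w) ≡ suc k
  vertices-length (stop s)   = refl
  vertices-length (step _ w) = cong suc (vertices-length w)

  vertices-head : ∀ {s t k} (w : Walk s t k) → T (headIsᵇ s (vertices w))
  vertices-head (stop s)   = fromWitness refl
  vertices-head (step _ w) = fromWitness refl

  vertices-last : ∀ {s t k} (w : Walk s t k) → T (lastIsᵇ t (vertices w))
  vertices-last (stop s)            = fromWitness refl
  vertices-last (step _ (stop u))   = fromWitness refl
  vertices-last (step _ (step a w)) = vertices-last (step a w)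

  vertices-walk : ∀ {s t k} (w : Walk s t k) → T (isWalkᵇ G (vertices w))
  vertices-walk (stop s)            = tt
  vertices-walk (step a (stop u))   = ∧-intro a tt
  vertices-walk (step a (step b w)) = ∧-intro a (vertices-walk (step b w))

  walk∈walks : ∀ {s t k} (w : Walk s t k) → vertices w ∈ walks G s t k
  walk∈walks w = ∈-filter⁺ _
    (subst (λ l → vertices w ∈ seqs l) (vertices-length w) (seqs-complete (vertices w)))
    (∧-intro (vertices-head w) (∧-intro (vertices-last w) (vertices-walk w)))

  fromList : ∀ {t} x xs → T (lastIsᵇ t (x ∷ xs)) → T (isWalkᵇ G (x ∷ xs)) →
             Σ (Walk x t (length xs)) (λ w → vertices w ≡ x ∷ xs)
  fromList x []       last _ with refl ← toWitness last = stop x , refl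
  fromList x (y ∷ ys) last adj-walk
    with a , rest ← ∧-elim {adj G x y} adj-walk
    with w , eq ← fromList y ys last rest = step a w , cong (x ∷_) eq

  walks⇒walk : ∀ {s t k p} → p ∈ walks G s t k → Σ (Walk s t k) (λ w → vertices w ≡ p)
  walks⇒walk {s} {t} {k} {p} p∈
    with ∈-filter⁻ (T? ∘ (λ p → headIsᵇ s p ∧ lastIsᵇ t p ∧ isWalkᵇ G p)) {xs = seqs (suc k)} p∈
  walks⇒walk {p = []} p∈ | _ , ()
  walks⇒walk {s} {t} {k} {x ∷ xs} p∈ | p∈seqs , ok
    with head , last-walk ← ∧-elim {headIsᵇ s (x ∷ xs)} ok
    with last , walk ← ∧-elim {lastIsᵇ t (x ∷ xs)} last-walk
    with refl ← toWitness head
    with refl ← ℕₚ.suc-injective (seqs-length (suc k) p∈seqs) = fromList x xs last walk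

  walk→nonEmpty : ∀ {s t k} → Walk s t k → T (nonEmptyᵇ {n} (walks G s t k))
  walk→nonEmpty w = nonEmpty-intro {n} (walk∈walks w)

  nonEmpty→walk : ∀ {s t k} → T (nonEmptyᵇ {n} (walks G s t k)) → Walk s t k
  nonEmpty→walk {s} {t} {k} ne with walks G s t k in eq
  ... | p ∷ _ = proj₁ (walks⇒walk (subst (p ∈_) (sym eq) (here refl)))

  IsPath : ∀ {s t k} → Walk s t k → Set
  IsPath (stop s)       = ⊤
  IsPath (step {s} _ w) = s ∉ vertices w × IsPath w

  PathWithin : Fin n → Fin n → ℕ → Set
  PathWithin s t k = ∃[ k′ ] k′ ℕ.≤ k × Σ (Walk s t k′) IsPath

  path-from : ∀ {x u t k} (w : Walk u t k) → IsPath w → x ∈ vertices w → PathWithin x t k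
  path-from (stop u)   _          (here refl) = 0 , z≤n , stop u , tt
  path-from (step a w) path       (here refl) = _ , ℕₚ.≤-refl , step a w , path
  path-from (step a w) (_ , path) (there x∈)
    with k′ , k′≤k , p ← path-from w path x∈ = k′ , ℕₚ.m≤n⇒m≤1+n k′≤k , p

  -- Cutting out cycles turns every walk into a path no longer than it.
  toPath : ∀ {s t k} → Walk s t k → PathWithin s t k
  toPath (stop s) = 0 , z≤n , stop s , tt
  toPath (step {s} a w) with k′ , k′≤k , w′ , path ← toPath w with s ∈? vertices w′
  ... | yes s∈ with k″ , k″≤k′ , p ← path-from w′ path s∈ = k″ , ℕₚ.m≤n⇒m≤1+n (ℕₚ.≤-trans k″≤k′ k′≤k) , p
  ... | no  s∉ = suc k′ , s≤s k′≤k , step a w′ , s∉ , path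

  vertexAt : ∀ {s t k} → Walk s t k → Fin (suc k) → Fin n
  vertexAt (stop s)       zero    = s
  vertexAt (step {s} _ w) zero    = s
  vertexAt (step _ w)     (suc i) = vertexAt w i

  vertexAt-∈ : ∀ {s t k} (w : Walk s t k) i → vertexAt w i ∈ vertices w
  vertexAt-∈ (stop s)   zero    = here refl
  vertexAt-∈ (step _ w) zero    = here refl
  vertexAt-∈ (step _ w) (suc i) = there (vertexAt-∈ w i)

  vertexAt-injective : ∀ {s t k} (w : Walk s t k) → IsPath w → ∀ {i j} → vertexAt w i ≡ vertexAt w j → i ≡ j
  vertexAt-injective (stop s)   _          {zero}  {zero}  _ = refl
  vertexAt-injective (step _ w) _          {zero}  {zero}  _ = refl
  vertexAt-injective (step _ w) (s∉ , _)   {zero}  {suc j} e = ⊥-elim (s∉ (subst (_∈ vertices w) (sym e) (vertexAt-∈ w j)))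
  vertexAt-injective (step _ w) (s∉ , _)   {suc i} {zero}  e = ⊥-elim (s∉ (subst (_∈ vertices w) e (vertexAt-∈ w i)))
  vertexAt-injective (step _ w) (_ , path) {suc i} {suc j} e = cong suc (vertexAt-injective w path e)

  -- Pigeonhole: a path visits k + 1 distinct vertices, so k < n.
  path-length : ∀ {s t k} (w : Walk s t k) → IsPath w → k ℕ.< n
  path-length w path = injective⇒≤ (vertexAt-injective w path)

  short-walk : ∀ {s t k} → Walk s t k → ∃[ k′ ] k′ ℕ.< n × Walk s t k′
  short-walk w with k′ , _ , w′ , path ← toPath w = k′ , path-length w′ path , w′

  search-finds : ∀ {s t} i fuel k → i ℕ.≤ k → k ℕ.< i ℕ.+ fuel → Walk s t k →
                 searchDist G s t i fuel ℕ.< i ℕ.+ fuel × Walk s t (searchDist G s t i fuel)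
  search-finds i zero k i≤k k<i+0 w =
    ⊥-elim (ℕₚ.<-irrefl refl (ℕₚ.≤-trans k<i+0 (subst (ℕ._≤ k) (sym (ℕₚ.+-identityʳ i)) i≤k)))
  search-finds {s} {t} i (suc fuel) k i≤k k<i+fuel w with nonEmptyᵇ {n} (walks G s t i) in found
  ... | true  = ℕₚ.m<m+n i (s≤s z≤n) , nonEmpty→walk (subst T (sym found) tt)
  ... | false with ℕₚ.m≤n⇒m<n∨m≡n i≤k
  ...   | inj₂ refl = ⊥-elim (subst T found (walk→nonEmpty w))
  ...   | inj₁ i<k
    with d<bound , walk ← search-finds (suc i) fuel k i<k (subst (k ℕ.<_) (ℕₚ.+-suc i fuel) k<i+fuel) w
    = subst (searchDist G s t (suc i) fuel ℕ.<_) (sym (ℕₚ.+-suc i fuel)) d<bound , walk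

  dist-spec : Connected G → ∀ s t → dist G s t ℕ.< n × Walk s t (dist G s t)
  dist-spec conn s t
    with k , ne ← conn s t
    with k′ , k′<n , w ← short-walk (nonEmpty→walk {s} {t} {k} (subst T (sym ne) tt))
    = search-finds 0 n k′ z≤n k′<n w

  ∈-dropLast : ∀ {r u t k} (w : Walk u t k) → r ∈ vertices w → r ≢ t → r ∈ dropLast (vertices w)
  ∈-dropLast (stop u)            (here refl)         r≢t = ⊥-elim (r≢t refl)
  ∈-dropLast (step a (stop v))   (here refl)         _   = here refl
  ∈-dropLast (step a (step b w)) (here refl)         _   = here refl
  ∈-dropLast (step a (stop v))   (there (here refl)) r≢t = ⊥-elim (r≢t refl)
  ∈-dropLast (step a (step b w)) (there r∈)          r≢t = there (∈-dropLast (step b w) r∈ r≢t)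

  ∈-interior : ∀ {r s t k} (w : Walk s t k) → r ∈ vertices w → r ≢ s → r ≢ t → r ∈ interior (vertices w)
  ∈-interior (stop s)   (here refl) r≢s _   = ⊥-elim (r≢s refl)
  ∈-interior (step _ w) (here refl) r≢s _   = ⊥-elim (r≢s refl)
  ∈-interior (step _ w) (there r∈)  _   r≢t = ∈-dropLast w r∈ r≢t

  reach-intro : ∀ {r u w k} (W : Walk u w k) → k ℕ.< n → r ∉ vertices W → T (reachAvoidᵇ G r u w)
  reach-intro {r} W k<n r∉ = any⁺ _ (lose (∈-upTo⁺ k<n) (nonEmpty-intro {n}
    (∈-filter⁺ (T? ∘ (λ p → not (any (eqᵇ r) p))) (walk∈walks W) (not-intro (r∉ ∘ any⇒∈ (vertices W))))))

  reach-self : ∀ {r u} → u ≢ r → T (reachAvoidᵇ G r u u)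
  reach-self {u = u} u≢r = reach-intro (stop u) (path-length (stop u) tt) λ { (here r≡u) → u≢r (sym r≡u) }

  separated : Connected G → ∀ {r u t} → u ≢ r → t ≢ r → ¬ T (reachAvoidᵇ G r u t) →
              σ-via G u t r ≡ σ G u t × 1 ℕ.≤ σ G u t
  separated conn {r} {u} {t} u≢r t≢r unreachable =
    cong length (filter-all (T? ∘ (λ p → any (eqᵇ r) (interior p))) (All.tabulate through)) ,
    ∈⇒length {n} (walk∈walks (proj₂ (dist-spec conn u t)))
    where
    through : ∀ {p} → p ∈ shortestPaths G u t → T (any (eqᵇ r) (interior p))
    through p∈ with W , vertices-W≡p ← walks⇒walk p∈ = subst (T ∘ any (eqᵇ r) ∘ interior) vertices-W≡p r∈interior
      where
      r∈interior : T (any (eqᵇ r) (interior (vertices W)))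
      r∈interior with r ∈? vertices W
      ... | yes r∈ = ∈⇒any (∈-interior W r∈ (u≢r ∘ sym) (t≢r ∘ sym))
      ... | no  r∉ = ⊥-elim (unreachable (reach-intro W (proj₁ (dist-spec conn u t)) r∉))

pairDependency : ∀ {n} → Graph n → Fin n → Fin n → Fin n → ℚ
pairDependency {n} G r u t = ratio {n} (σ-via G u t r) (σ G u t)

targets : ∀ {n} → Fin n → Fin n → List (Fin n)
targets {n} r w = filterᵇ (λ t → not (eqᵇ t r ∨ eqᵇ t w)) (allFin n)

module _ {n : ℕ} (G : Graph n) (r : Fin n) where

  δ-unfold : ∀ {w} → w ≢ r → δ G w r ≡ sumℚ {n} (map (pairDependency G r w) (targets r w))
  δ-unfold {w} w≢r with w ≟ r
  ... | yes w≡r = ⊥-elim (w≢r w≡r)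
  ... | no  _   = refl

  -- 0 ≤ σ_ut(r)/σ_ut ≤ 1, since σ_ut(r) counts a subset of the shortest paths.
  pairDependency-nonneg : ∀ u t → 0ℚ ≤ pairDependency G r u t
  pairDependency-nonneg u t = ratio-nonneg {n} (σ-via G u t r) (σ G u t)

  pairDependency-≤-1 : ∀ u t → pairDependency G r u t ≤ 1ℚ
  pairDependency-≤-1 u t = ratio-≤-1 {n} (length-filter (T? ∘ (λ p → any (eqᵇ r) (interior p))) (shortestPaths G u t))

  pairDependency-separated : Connected G → ∀ {u t} → u ≢ r → t ≢ r → ¬ T (reachAvoidᵇ G r u t) →
                             pairDependency G r u t ≡ 1ℚ
  pairDependency-separated conn u≢r t≢r unreachable =
    let via≡σ , σ≥1 = separated G conn u≢r t≢r unreachable in ratio-self {n} via≡σ σ≥1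

  δ-nonneg : ∀ w → 0ℚ ≤ δ G w r
  δ-nonneg w with w ≟ r
  ... | yes _ = ≤-refl
  ... | no  _ = sum-nonneg {n} (pairDependency G r w) (targets r w) (pairDependency-nonneg w)

module _ {m : ℕ} (G : Graph (suc m)) (r : Fin (suc m)) where

  -- δ_{v•}(r) ≤ m: at most m terms, as t = r is excluded, each at most 1.
  δ-≤ : ∀ v → δ G v r ≤ ι m
  δ-≤ v with v ≟ r
  ... | yes _ = ι-mono {0} {m} z≤n
  ... | no  _ = ≤-trans (sum-≤-length {suc m} (pairDependency G r v) (targets r v) (pairDependency-≤-1 G r v)) (ι-mono fewer)
    where
    fewer : length (targets r v) ℕ.≤ m
    fewer = ℕₚ.≤-pred (subst (length (targets r v) ℕ.<_) (length-tabulate (λ i → i))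
      (filter-notAll (T? ∘ (λ t → not (eqᵇ t r ∨ eqᵇ t v))) (allFin (suc m))
        (lose (∈-allFin r) λ r-kept → proj₁ (nor-elim {eqᵇ r r} {eqᵇ r v} r-kept) (fromWitness {a? = r ≟ r} refl))))

  -- At least m − |C| vertices lie neither in the component C of w in G − r
  -- nor at r: every vertex is in C, is r, or is such a vertex.
  outside-count : ∀ w → m ℕ.∸ compSize G r w ℕ.≤ count (λ t → not (reachAvoidᵇ G r w t ∨ eqᵇ t r)) (allFin (suc m))
  outside-count w = ℕₚ.m≤n+o⇒m∸n≤o m (compSize G r w) (ℕₚ.≤-pred (begin
    suc m                                       ≡⟨ sym (length-tabulate (λ i → i)) ⟩
    length (allFin (suc m))                     ≤⟨ count-cover (reachAvoidᵇ G r w) (λ t → eqᵇ t r) (allFin (suc m)) ⟩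
    compSize G r w ℕ.+ (count (λ t → eqᵇ t r) (allFin (suc m)) ℕ.+ outside)
                                                ≡⟨ cong (λ k → compSize G r w ℕ.+ (k ℕ.+ outside)) (count-eq r) ⟩
    compSize G r w ℕ.+ suc outside              ≡⟨ ℕₚ.+-suc (compSize G r w) outside ⟩
    suc (compSize G r w ℕ.+ outside)            ∎))
    where
    open ℕₚ.≤-Reasoning
    outside = count (λ t → not (reachAvoidᵇ G r w t ∨ eqᵇ t r)) (allFin (suc m))

  -- δ_{w•}(r) ≥ V_i for the component C_i of G − r containing w: each t ≠ r
  -- outside C_i contributes the pair dependency 1.
  δ-≥ : Connected G → ∀ w → w ≢ r → ι (otherCompsSize G r w) ≤ δ G w r
  δ-≥ conn w w≢r = begin
    ι (m ℕ.∸ compSize G r w)          ≤⟨ ι-mono (outside-count w) ⟩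
    ι (count outside (allFin (suc m))) ≡⟨ sym (*-identityʳ _) ⟩
    ι (count outside (allFin (suc m))) * 1ℚ
      ≤⟨ sum-filter-≥ {suc m} (λ t → not (eqᵇ t r ∨ eqᵇ t w)) outside (pairDependency G r w) 1ℚ (allFin (suc m))
                      (pairDependency-nonneg G r w) contributes ⟩
    sumℚ {suc m} (map (pairDependency G r w) (targets r w)) ≡⟨ sym (δ-unfold G r w≢r) ⟩
    δ G w r                          ∎
    where
    open ≤-Reasoning
    reaches : Fin (suc m) → Bool
    reaches = reachAvoidᵇ G r w
    outside : Fin (suc m) → Bool
    outside t = not (reaches t ∨ eqᵇ t r)
    contributes : ∀ t → T (outside t) → T (not (eqᵇ t r ∨ eqᵇ t w)) × 1ℚ ≤ pairDependency G r w t
    contributes t t-outside =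
      nor-intro {eqᵇ t r} {eqᵇ t w} (t≢r ∘ toWitness) (t≢w ∘ toWitness) ,
      ≤-reflexive (sym (pairDependency-separated G r conn w≢r t≢r unreachable))
      where
      unreachable = proj₁ (nor-elim {reaches t} {eqᵇ t r} t-outside)
      t≢r : t ≢ r
      t≢r t≡r = proj₂ (nor-elim {reaches t} {eqᵇ t r} t-outside) (fromWitness {a? = t ≟ r} t≡r)
      t≢w : t ≢ w
      t≢w refl = unreachable (reach-self G w≢r)

  total-≥ : Connected G → ∀ X → (∀ u → u ≢ r → X ≤ ι (otherCompsSize G r u)) →
            ι m * X ≤ sumℚ {suc m} (map (λ w → δ G w r) (allFin (suc m)))
  total-≥ conn X X≤V = begin
    ι m * X                                                       ≡⟨ cong (λ k → ι k * X) (sym (count-≢ r)) ⟩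
    ι (count (λ w → not (eqᵇ w r)) (allFin (suc m))) * X
      ≤⟨ sum-filter-≥ {suc m} (λ _ → true) (λ w → not (eqᵇ w r)) (λ w → δ G w r) X (allFin (suc m)) (δ-nonneg G r) large ⟩
    sumℚ {suc m} (map (λ w → δ G w r) (filterᵇ (λ _ → true) (allFin (suc m))))
      ≡⟨ cong (sumℚ {suc m} ∘ map (λ w → δ G w r)) (filter-all (T? ∘ (λ _ → true)) (All.universal (λ _ → tt) (allFin (suc m)))) ⟩
    sumℚ {suc m} (map (λ w → δ G w r) (allFin (suc m)))           ∎
    where
    open ≤-Reasoning
    large : ∀ w → T (not (eqᵇ w r)) → T true × X ≤ δ G w r
    large w w-kept = tt , ≤-trans (X≤V w w≢r) (δ-≥ conn w w≢r)
      where w≢r = not-elim w-kept ∘ fromWitness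

  average-≥ : Connected G → ∀ c → (∀ u → u ≢ r → c * ι (suc m) ≤ ι (otherCompsSize G r u)) →
              c * ι m ≤ δ-avg G r
  average-≥ conn c cN≤V = begin
    c * ι m                                        ≡⟨ sym rescale ⟩
    (ι m * (c * ι (suc m))) * ratio {suc m} 1 (suc m)
      ≤⟨ *-monoʳ-≤-nonNeg (ratio {suc m} 1 (suc m)) {{nonNeg}} (total-≥ conn (c * ι (suc m)) cN≤V) ⟩
    δ-avg G r                                      ∎
    where
    open ≤-Reasoning
    nonNeg : NonNegative (ratio {suc m} 1 (suc m))
    nonNeg = nonNegative (ratio-nonneg {suc m} 1 (suc m))
    rescale : (ι m * (c * ι (suc m))) * ratio {suc m} 1 (suc m) ≡ c * ι m
    rescale = begin-equality
      (ι m * (c * ι (suc m))) * ratio {suc m} 1 (suc m)  ≡⟨ *-assoc (ι m) (c * ι (suc m)) _ ⟩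
      ι m * ((c * ι (suc m)) * ratio {suc m} 1 (suc m))  ≡⟨ cong (ι m *_) (*-assoc c (ι (suc m)) _) ⟩
      ι m * (c * (ι (suc m) * ratio {suc m} 1 (suc m)))  ≡⟨ cong (λ x → ι m * (c * x)) (ι-*-ratio {suc m} m) ⟩
      ι m * (c * 1ℚ)                                     ≡⟨ cong (ι m *_) (*-identityʳ c) ⟩
      ι m * c                                            ≡⟨ *-comm (ι m) c ⟩
      c * ι m                                            ∎

theorem2 : (F : (n : ℕ) → Graph n → Fin n → Set)
    → (∀ n G r → F n G r → Connected G)
    → (c : ℚ) → 0ℚ < c
    → (∀ n G r → F n G r → ∀ (u : Fin n) → ¬ (u ≡ r)
    → c * ((+ n) / 1) ≤ (+ otherCompsSize G r u) / 1)
    → ∃[ C ] (∀ n G r → F n G r → ∀ (v : Fin n) → δ G v r ≤ C * δ-avg G r)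
theorem2 F connected c c>0 components-large = 1/ c , bound
  where
  instance
    c≢0 : NonZero c
    c≢0 = pos⇒nonZero c {{positive c>0}}
    1/c≥0 : NonNegative (1/ c)
    1/c≥0 = pos⇒nonNeg (1/ c) {{1/pos⇒pos c {{positive c>0}}}}
  bound : ∀ n G r → F n G r → ∀ (v : Fin n) → δ G v r ≤ (1/ c) * δ-avg G r
  bound (suc m) G r member v = begin
    δ G v r               ≤⟨ δ-≤ G r v ⟩
    ι m                   ≡⟨ sym (*-identityˡ (ι m)) ⟩
    1ℚ * ι m              ≡⟨ cong (_* ι m) (sym (*-inverseˡ c)) ⟩
    ((1/ c) * c) * ι m    ≡⟨ *-assoc (1/ c) c (ι m) ⟩
    (1/ c) * (c * ι m)    ≤⟨ *-monoˡ-≤-nonNeg (1/ c) (average-≥ G r (connected _ G r member) c (components-large _ G r member)) ⟩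
    (1/ c) * δ-avg G r    ∎
    where open ≤-Reasoning
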